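{- Let $M$ be a matroid of rank $r$ without coloops. Then for every integer $i$ with $0\le i\le r$, $$h_{r-i}(M)\le \binom{r-1}{i}h_r(M)+\binom{r-1}{i-1}.$$
   Context: $h_i(M)$ is the $h$-vector of the independence complex of $M$ (the complex of independent sets, of dimension $r-1$): $h_i=\sum_{k=0}^i(-1)^{i-k}\binom{r-k}{r-i}f_k$ with $f_k$ the number of independent sets of size $k$. A coloop is an element contained in every basis. Binomial coefficients $\binom{a}{b}=a(a-1)\cdots(a-b+1)/b!$ for $b\ge0$ and $0$ for $b<0$. -}

module Defs where

open import Data.Nat as ℕ using (ℕ; zero; suc; _∸_; _≤_; _!)
open import Data.Nat.Properties using (_!≢0)
open import Data.Nat.Combinatorics using (_C_)
open import Data.Integer as ℤ using (ℤ; +_; -[1+_]; _/ℕ_)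
open import Data.Fin using (Fin)
open import Data.Fin.Subset using (Subset; _⊆_; _⊂_; _∈_; ∣_∣; outside; inside; ⊥; _∪_; ⁅_⁆)
open import Data.Vec using ([]; _∷_)
open import Data.List using (List; []; _∷_; map; _++_; filter; length)
open import Data.Product using (Σ; _×_; _,_)
open import Relation.Nullary using (¬_; Dec)
open import Relation.Nullary.Decidable using (_×-dec_)
open import Relation.Unary using (Decidable)
open import Relation.Binary.PropositionalEquality using (_≡_)

record Matroid (n : ℕ) : Set₁ where
  field
    Indep     : Subset n → Set
    indep?    : Decidable Indep
    indep-∅   : Indep (⊥)
    indep-⊆   : ∀ {A B} → A ⊆ B → Indep B → Indep A
    augment   : ∀ {A B} → Indep A → Indep B → ∣ A ∣ ℕ.< ∣ B ∣ →
                Σ (Fin n) λ e → e ∈ B × ¬ (e ∈ A) × Indep (A ∪ ⁅ e ⁆)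

open Matroid public

HasRank : ∀ {n} → Matroid n → ℕ → Set
HasRank M r = Σ _ (λ B → Indep M B × ∣ B ∣ ≡ r) × (∀ A → Indep M A → ∣ A ∣ ≤ r)

IsBasis : ∀ {n} → Matroid n → Subset n → Set
IsBasis M B = Indep M B × (∀ A → B ⊂ A → ¬ Indep M A)

IsColoop : ∀ {n} → Matroid n → Fin n → Set
IsColoop M e = ∀ B → IsBasis M B → e ∈ B

NoColoops : ∀ {n} → Matroid n → Set
NoColoops M = ∀ e → ¬ IsColoop M e

allSubsets : ∀ n → List (Subset n)
allSubsets zero = [] ∷ []
allSubsets (suc n) = map (outside ∷_) (allSubsets n) ++ map (inside ∷_) (allSubsets n)

fvec : ∀ {n} → Matroid n → ℕ → ℕ
fvec {n} M k = length (filter (λ S → indep? M S ×-dec (∣ S ∣ ℕ.≟ k)) (allSubsets n))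

falling : ℤ → ℕ → ℤ
falling a zero = + 1
falling a (suc b) = falling a b ℤ.* (a ℤ.- + b)

binomℤ : ℤ → ℤ → ℤ
binomℤ a (+ b) = (falling a b /ℕ (b !)) {{b !≢0}}
binomℤ a -[1+ _ ] = + 0

sign^ : ℕ → ℤ
sign^ zero = + 1
sign^ (suc m) = ℤ.- sign^ m

sumTo : ℕ → (ℕ → ℤ) → ℤ
sumTo zero g = g 0
sumTo (suc i) g = sumTo i g ℤ.+ g (suc i)

-- h-vector of the independence complex of a rank-r matroid:
-- h_i = Σ_{k=0}^{i} (-1)^{i-k} C(r-k, r-i) f_k   (used for 0 ≤ i ≤ r)
hvec : ∀ {n} → Matroid n → (r i : ℕ) → ℤ
hvec M r i = sumTo i λ k →
  sign^ (i ∸ k) ℤ.* binomℤ (+ r ℤ.- + k) (+ r ℤ.- + i) ℤ.* + fvec M k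

module Submission where

-- Deletion–contraction at one element e. If e is neither a loop nor a coloop, then
-- f(M) = f(M ∖ e) + shift f(M / e), so h_{i+1}(M) = h_{i+1}(M ∖ e) + h_i(M / e) with M / e of rank r − 1,
-- while deleting a loop changes nothing. This recursion alone gives h ≥ 0, and h_r ≥ 1 when M has no
-- coloops. If M ∖ e has no coloop, the
-- bounds for M ∖ e and M / e add up by Pascal's rule, the surplus C(r−2, i−1) being absorbed by
-- h_{r−1}(M / e) ≥ 1. Otherwise M ∖ e has a coloop f and {e, f} is a series pair; then h_r(M ∖ e) = 0
-- and h(M ∖ e) ≤ h(M / e) termwise, and the bounds for M / e at i − 1 and at i add up instead.

open import Defs
open import Data.Nat as ℕ using (ℕ; zero; suc; _+_; _∸_; _≤_; _<_; z≤n; s≤s; _!)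
import Data.Nat.Properties as ℕP
open import Data.Nat.Properties using (_!≢0)
open import Data.Nat.DivMod using (0/n≡0)
open import Data.Nat.Combinatorics
  using (_C_; _P_; nCn≡1; nCk+nC[k+1]≡[n+1]C[k+1]; k>n⇒nCk≡0; nCk≡nPk/k!; nPk≡n!/[n∸k]!)
open import Data.Nat.Combinatorics.Base using (_P′_)
open import Data.Nat.Combinatorics.Specification using (nP′k≡n!/[n∸k]!)
open import Data.Integer as ℤ using (ℤ; +_; _/ℕ_)
import Data.Integer.Properties as ℤP
open import Data.Integer.Solver using (module +-*-Solver)
open import Algebra.Properties.CommutativeSemigroup ℕP.+-commutativeSemigroup
  using () renaming (interchange to +-interchange)
open import Algebra.Properties.CommutativeSemigroup ℤP.+-commutativeSemigroup
  using () renaming (interchange to ℤ+-interchange)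
open import Data.Fin as Fin using (Fin; zero; suc; punchIn; punchOut)
open import Data.Fin.Properties using (punchIn-punchOut; punchInᵢ≢i; all?; ¬∀⟶∃¬)
open import Data.Fin.Subset using (Subset; Side; _⊆_; _⊂_; _∈_; _∉_; ∣_∣; outside; inside; ⊥; _∪_; ⁅_⁆)
import Data.Fin.Subset.Properties as SubsetP
open import Data.Vec using ([]; _∷_; lookup; insertAt; removeAt; here; there)
open import Data.Vec.Properties
  using (insertAt-lookup; insertAt-punchIn; insertAt-removeAt; []=⇒lookup; lookup⇒[]=)
open import Data.List as List using (List; length; filter; _++_)
open import Data.List.Properties using (filter-++; length-++; filter-≐; filter-none; filter-accept)
import Data.List.Relation.Unary.All as All
open import Data.Bool using (true; false)
open import Data.Product using (Σ-syntax; _×_; _,_; proj₁; proj₂)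
open import Data.Sum using (_⊎_; inj₁; inj₂)
open import Data.Empty using (⊥-elim)
open import Function using (_∘_)
open import Level using (0ℓ)
open import Relation.Nullary using (¬_; Dec; yes; no; does)
open import Relation.Nullary.Decidable using (_×-dec_; ¬?)
open import Relation.Unary using (Pred; Decidable; _≐_)
open import Relation.Binary.Definitions using (tri<; tri≈; tri>)
open import Relation.Binary.PropositionalEquality

private variable n : ℕ

data PunchInView (p : Fin (suc n)) : Fin (suc n) → Set where
  at-p    : PunchInView p p
  punched : ∀ x → PunchInView p (punchIn p x)

punchInView : (p y : Fin (suc n)) → PunchInView p y
punchInView p y with p Fin.≟ y
... | yes refl = at-p
... | no p≢y   = subst (PunchInView p) (punchIn-punchOut p≢y) (punched (punchOut p≢y))

∣insertAt∣ : (S : Subset n) (p : Fin (suc n)) (b : Side) → ∣ insertAt S p b ∣ ≡ ∣ b ∷ S ∣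
∣insertAt∣ S             zero    b       = refl
∣insertAt∣ (outside ∷ S) (suc p) outside = ∣insertAt∣ S p outside
∣insertAt∣ (outside ∷ S) (suc p) inside  = ∣insertAt∣ S p inside
∣insertAt∣ (inside ∷ S)  (suc p) outside = cong suc (∣insertAt∣ S p outside)
∣insertAt∣ (inside ∷ S)  (suc p) inside  = cong suc (∣insertAt∣ S p inside)

module _ {S : Subset n} (p : Fin (suc n)) where

  p∈insertAt-inside : p ∈ insertAt S p inside
  p∈insertAt-inside = lookup⇒[]= p _ (insertAt-lookup S p inside)

  p∉insertAt-outside : p ∉ insertAt S p outside
  p∉insertAt-outside p∈ with () ← trans (sym (insertAt-lookup S p outside)) ([]=⇒lookup p∈)

  punchIn∈insertAt⁺ : ∀ {b x} → x ∈ S → punchIn p x ∈ insertAt S p b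
  punchIn∈insertAt⁺ {b} {x} x∈ = lookup⇒[]= _ _ (trans (insertAt-punchIn S p b x) ([]=⇒lookup x∈))

  punchIn∈insertAt⁻ : ∀ {b x} → punchIn p x ∈ insertAt S p b → x ∈ S
  punchIn∈insertAt⁻ {b} {x} x∈ = lookup⇒[]= x S (trans (sym (insertAt-punchIn S p b x)) ([]=⇒lookup x∈))

p∈insertAt-swap : ∀ {A B : Subset n} (p : Fin (suc n)) {b} → p ∈ insertAt A p b → p ∈ insertAt B p b
p∈insertAt-swap {A = A} {B} p {b} p∈ = lookup⇒[]= p _
  (trans (insertAt-lookup B p b) (trans (sym (insertAt-lookup A p b)) ([]=⇒lookup p∈)))

insertAt-mono : ∀ {A B : Subset n} (p : Fin (suc n)) {b} → A ⊆ B → insertAt A p b ⊆ insertAt B p b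
insertAt-mono p A⊆B {y} y∈ with punchInView p y
... | at-p      = p∈insertAt-swap p y∈
... | punched x = punchIn∈insertAt⁺ p (A⊆B (punchIn∈insertAt⁻ p y∈))

insertAt-outside⊆inside : ∀ {S : Subset n} (p : Fin (suc n)) → insertAt S p outside ⊆ insertAt S p inside
insertAt-outside⊆inside p {y} y∈ with punchInView p y
... | at-p      = ⊥-elim (p∉insertAt-outside p y∈)
... | punched x = punchIn∈insertAt⁺ p (punchIn∈insertAt⁻ p y∈)

insertAt-inside-⊆ : ∀ {U : Subset n} {X} (p : Fin (suc n)) →
                    p ∈ X → insertAt U p outside ⊆ X → insertAt U p inside ⊆ X
insertAt-inside-⊆ p p∈X U⊆X {y} y∈ with punchInView p y
... | at-p      = p∈X
... | punched x = U⊆X (punchIn∈insertAt⁺ p (punchIn∈insertAt⁻ p y∈))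

⁅p⁆⊆insertAt-inside : ∀ {S : Subset n} (p : Fin (suc n)) → ⁅ p ⁆ ⊆ insertAt S p inside
⁅p⁆⊆insertAt-inside p y∈ rewrite SubsetP.x∈⁅y⁆⇒x≡y p y∈ = p∈insertAt-inside p

insertAt-⊥-outside : (p : Fin (suc n)) → insertAt ⊥ p outside ≡ ⊥
insertAt-⊥-outside zero            = refl
insertAt-⊥-outside {suc n} (suc p) = cong (outside ∷_) (insertAt-⊥-outside p)

insertAt-⊥-inside : (p : Fin (suc n)) → insertAt ⊥ p inside ≡ ⁅ p ⁆
insertAt-⊥-inside zero            = refl
insertAt-⊥-inside {suc n} (suc p) = cong (outside ∷_) (insertAt-⊥-inside p)

insertAt-∪⁅⁆ : ∀ (A : Subset n) (p : Fin (suc n)) b x →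
               insertAt (A ∪ ⁅ x ⁆) p b ⊆ insertAt A p b ∪ ⁅ punchIn p x ⁆
insertAt-∪⁅⁆ A p b x {y} y∈ with punchInView p y
... | at-p = SubsetP.p⊆p∪q _ (p∈insertAt-swap p y∈)
... | punched z with SubsetP.x∈p∪q⁻ A ⁅ x ⁆ (punchIn∈insertAt⁻ p y∈)
...   | inj₁ z∈A = SubsetP.p⊆p∪q _ (punchIn∈insertAt⁺ p z∈A)
...   | inj₂ z∈x rewrite SubsetP.x∈⁅y⁆⇒x≡y x z∈x = SubsetP.q⊆p∪q _ _ (SubsetP.x∈⁅x⁆ (punchIn p x))

removeAt-outside : ∀ {B : Subset (suc n)} (p : Fin (suc n)) → p ∉ B → insertAt (removeAt B p) p outside ≡ B
removeAt-outside {B = B} p p∉B with lookup B p in eq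
... | outside = trans (cong (insertAt (removeAt B p) p) (sym eq)) (insertAt-removeAt B p)
... | inside  = ⊥-elim (p∉B (lookup⇒[]= p B eq))

removeAt-inside : ∀ {B : Subset (suc n)} (p : Fin (suc n)) → p ∈ B → insertAt (removeAt B p) p inside ≡ B
removeAt-inside {B = B} p p∈B =
  trans (cong (insertAt (removeAt B p) p) (sym ([]=⇒lookup p∈B))) (insertAt-removeAt B p)

∣removeAt∣-∉ : ∀ {B : Subset (suc n)} (p : Fin (suc n)) → p ∉ B → ∣ removeAt B p ∣ ≡ ∣ B ∣
∣removeAt∣-∉ {B = B} p p∉B =
  trans (sym (∣insertAt∣ (removeAt B p) p outside)) (cong ∣_∣ (removeAt-outside p p∉B))

∣removeAt∣-∈ : ∀ {B : Subset (suc n)} (p : Fin (suc n)) → p ∈ B → suc ∣ removeAt B p ∣ ≡ ∣ B ∣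
∣removeAt∣-∈ {B = B} p p∈B =
  trans (sym (∣insertAt∣ (removeAt B p) p inside)) (cong ∣_∣ (removeAt-inside p p∈B))

punchIn∉removeAt : ∀ {B : Subset (suc n)} (p : Fin (suc n)) {b x} →
                   insertAt (removeAt B p) p b ≡ B → punchIn p x ∉ B → x ∉ removeAt B p
punchIn∉removeAt p {x = x} eq px∉B x∈ = px∉B (subst (punchIn p x ∈_) eq (punchIn∈insertAt⁺ p x∈))

∣∪⁅⁆∣ : (A : Subset n) (e : Fin n) → e ∉ A → ∣ A ∪ ⁅ e ⁆ ∣ ≡ suc ∣ A ∣
∣∪⁅⁆∣ (inside ∷ A)  zero    e∉A = ⊥-elim (e∉A here)
∣∪⁅⁆∣ (outside ∷ A) zero    e∉A = cong (suc ∘ ∣_∣) (SubsetP.∪-identityʳ A)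
∣∪⁅⁆∣ (inside ∷ A)  (suc e) e∉A = cong suc (∣∪⁅⁆∣ A e (e∉A ∘ there))
∣∪⁅⁆∣ (outside ∷ A) (suc e) e∉A = ∣∪⁅⁆∣ A e (e∉A ∘ there)

length-filter-map : ∀ {A B : Set} {P : Pred B 0ℓ} (P? : Decidable P) (f : A → B) (xs : List A) →
                    length (filter P? (List.map f xs)) ≡ length (filter (P? ∘ f) xs)
length-filter-map P? f List.[]        = refl
length-filter-map P? f (x List.∷ xs) with does (P? (f x))
... | true  = cong suc (length-filter-map P? f xs)
... | false = length-filter-map P? f xs

countSubsets : ∀ {P : Pred (Subset n) 0ℓ} → Decidable P → ℕ
countSubsets {n} P? = length (filter P? (allSubsets n))

countSubsets-cong : ∀ {P Q : Pred (Subset n) 0ℓ} (P? : Decidable P) (Q? : Decidable Q) →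
                    P ≐ Q → countSubsets P? ≡ countSubsets Q?
countSubsets-cong {n} P? Q? P≐Q = cong length (filter-≐ P? Q? P≐Q (allSubsets n))

countSubsets-none : ∀ {P : Pred (Subset n) 0ℓ} (P? : Decidable P) → (∀ S → ¬ P S) → countSubsets P? ≡ 0
countSubsets-none {n} P? ¬P = cong length (filter-none P? (All.universal ¬P (allSubsets n)))

countSubsets-head : ∀ {P : Pred (Subset (suc n)) 0ℓ} (P? : Decidable P) →
  countSubsets P? ≡ countSubsets (λ S → P? (outside ∷ S)) + countSubsets (λ S → P? (inside ∷ S))
countSubsets-head {n} P? = begin
  length (filter P? (List.map (outside ∷_) all ++ List.map (inside ∷_) all))
    ≡⟨ cong length (filter-++ P? (List.map (outside ∷_) all) _) ⟩
  length (filter P? (List.map (outside ∷_) all) ++ filter P? (List.map (inside ∷_) all))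
    ≡⟨ length-++ (filter P? (List.map (outside ∷_) all)) ⟩
  _ ≡⟨ cong₂ _+_ (length-filter-map P? (outside ∷_) all) (length-filter-map P? (inside ∷_) all) ⟩
  _ ∎
  where
  open ≡-Reasoning
  all : List (Subset n)
  all = allSubsets n

countSubsets-insertAt : ∀ {P : Pred (Subset (suc n)) 0ℓ} (P? : Decidable P) (p : Fin (suc n)) →
  countSubsets P? ≡
  countSubsets (λ S → P? (insertAt S p outside)) + countSubsets (λ S → P? (insertAt S p inside))
countSubsets-insertAt P? zero = countSubsets-head P?
countSubsets-insertAt {suc n} P? (suc p) = begin
  countSubsets P?
    ≡⟨ countSubsets-head P? ⟩
  countSubsets (λ S → P? (outside ∷ S)) + countSubsets (λ S → P? (inside ∷ S))
    ≡⟨ cong₂ _+_ (countSubsets-insertAt (λ S → P? (outside ∷ S)) p)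
                 (countSubsets-insertAt (λ S → P? (inside ∷ S)) p) ⟩
  (c outside outside + c outside inside) + (c inside outside + c inside inside)
    ≡⟨ +-interchange (c outside outside) (c outside inside) (c inside outside) (c inside inside) ⟩
  (c outside outside + c inside outside) + (c outside inside + c inside inside)
    ≡⟨ cong₂ _+_ (countSubsets-head (λ S → P? (insertAt S (suc p) outside)))
                 (countSubsets-head (λ S → P? (insertAt S (suc p) inside))) ⟨
  countSubsets (λ S → P? (insertAt S (suc p) outside)) + countSubsets (λ S → P? (insertAt S (suc p) inside)) ∎
  where
  open ≡-Reasoning
  c : Side → Side → ℕ
  c x b = countSubsets (λ S → P? (x ∷ insertAt S p b))

sized : ∀ {P : Pred (Subset n) 0ℓ} → Decidable P → (k : ℕ) → Decidable (λ S → P S × ∣ S ∣ ≡ k)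
sized P? k S = P? S ×-dec (∣ S ∣ ℕ.≟ k)

countOfSize : ∀ {P : Pred (Subset n) 0ℓ} → Decidable P → ℕ → ℕ
countOfSize P? k = countSubsets (sized P? k)

countOfSize-cong : ∀ {P Q : Pred (Subset n) 0ℓ} (P? : Decidable P) (Q? : Decidable Q) →
                   (∀ {S} → P S → Q S) → (∀ {S} → Q S → P S) →
                   ∀ k → countOfSize P? k ≡ countOfSize Q? k
countOfSize-cong P? Q? P⇒Q Q⇒P k = countSubsets-cong (sized P? k) (sized Q? k)
  ((λ (pS , ∣S∣) → P⇒Q pS , ∣S∣) , (λ (qS , ∣S∣) → Q⇒P qS , ∣S∣))

countOfSize-0 : ∀ {P : Pred (Subset n) 0ℓ} (P? : Decidable P) → P ⊥ → countOfSize P? 0 ≡ 1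
countOfSize-0 {zero}  P? P⊥ = cong length (filter-accept (sized P? 0) (P⊥ , refl))
countOfSize-0 {suc n} P? P⊥ = begin
  countOfSize P? 0
    ≡⟨ countSubsets-head (sized P? 0) ⟩
  countOfSize (λ S → P? (outside ∷ S)) 0 + countSubsets (λ S → sized P? 0 (inside ∷ S))
    ≡⟨ cong₂ _+_ (countOfSize-0 (λ S → P? (outside ∷ S)) P⊥)
                 (countSubsets-none (λ S → sized P? 0 (inside ∷ S)) (λ { _ (_ , ()) })) ⟩
  1 ∎
  where open ≡-Reasoning

shift : (ℕ → ℕ) → ℕ → ℕ
shift g zero    = 0
shift g (suc k) = g k

countOfSize-insertAt : ∀ {P : Pred (Subset (suc n)) 0ℓ} (P? : Decidable P) (p : Fin (suc n)) k →
  countOfSize P? k ≡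
  countOfSize (λ S → P? (insertAt S p outside)) k + shift (countOfSize (λ S → P? (insertAt S p inside))) k
countOfSize-insertAt P? p k =
  trans (countSubsets-insertAt (sized P? k) p) (cong₂ _+_ without (through k))
  where
  without : countSubsets (λ S → sized P? k (insertAt S p outside))
            ≡ countOfSize (λ S → P? (insertAt S p outside)) k
  without = countSubsets-cong (λ S → sized P? k (insertAt S p outside))
                              (sized (λ S → P? (insertAt S p outside)) k)
    ( (λ {S} (pS , size) → pS , trans (sym (∣insertAt∣ S p outside)) size)
    , (λ {S} (pS , size) → pS , trans (∣insertAt∣ S p outside) size))
  through : ∀ k → countSubsets (λ S → sized P? k (insertAt S p inside))
                  ≡ shift (countOfSize (λ S → P? (insertAt S p inside))) k
  through zero    = countSubsets-none (λ S → sized P? 0 (insertAt S p inside))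
    (λ S (_ , size) → ℕP.1+n≢0 (trans (sym (∣insertAt∣ S p inside)) size))
  through (suc k) = countSubsets-cong (λ S → sized P? (suc k) (insertAt S p inside))
                                      (sized (λ S → P? (insertAt S p inside)) k)
    ( (λ {S} (pS , size) → pS , ℕP.suc-injective (trans (sym (∣insertAt∣ S p inside)) size))
    , (λ {S} (pS , size) → pS , trans (∣insertAt∣ S p inside) (cong suc size)))

-- The h-transform of a sequence

sumTo-cong : ∀ i {F G : ℕ → ℤ} → (∀ k → k ≤ i → F k ≡ G k) → sumTo i F ≡ sumTo i G
sumTo-cong zero    F≡G = F≡G 0 z≤n
sumTo-cong (suc i) F≡G =
  cong₂ ℤ._+_ (sumTo-cong i (λ k k≤i → F≡G k (ℕP.m≤n⇒m≤1+n k≤i))) (F≡G (suc i) ℕP.≤-refl)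

sumTo-+ : ∀ i (F G : ℕ → ℤ) → sumTo i (λ k → F k ℤ.+ G k) ≡ sumTo i F ℤ.+ sumTo i G
sumTo-+ zero    F G = refl
sumTo-+ (suc i) F G = trans (cong (ℤ._+ (F (suc i) ℤ.+ G (suc i))) (sumTo-+ i F G))
                            (ℤ+-interchange (sumTo i F) (sumTo i G) (F (suc i)) (G (suc i)))

sumTo-neg : ∀ i (F : ℕ → ℤ) → sumTo i (λ k → ℤ.- F k) ≡ ℤ.- sumTo i F
sumTo-neg zero    F = refl
sumTo-neg (suc i) F = trans (cong (ℤ._+ (ℤ.- F (suc i))) (sumTo-neg i F))
                            (sym (ℤP.neg-distrib-+ (sumTo i F) (F (suc i))))

sumTo-suc : ∀ i (F : ℕ → ℤ) → sumTo (suc i) F ≡ F 0 ℤ.+ sumTo i (F ∘ suc)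
sumTo-suc zero    F = refl
sumTo-suc (suc i) F = trans (cong (ℤ._+ F (suc (suc i))) (sumTo-suc i F)) (ℤP.+-assoc (F 0) _ _)

hTerm : (ℕ → ℕ) → ℕ → ℕ → ℕ → ℤ
hTerm f r i k = sign^ (i ∸ k) ℤ.* + ((r ∸ k) C (r ∸ i)) ℤ.* + f k

-- Defs.hvec with natural instead of integer binomial coefficients; the two agree for i ≤ r.
hTransform : (ℕ → ℕ) → ℕ → ℕ → ℤ
hTransform f r i = sumTo i (hTerm f r i)

hTransform-cong : ∀ {f g} → (∀ k → f k ≡ g k) → ∀ r i → hTransform f r i ≡ hTransform g r i
hTransform-cong f≡g r i = sumTo-cong i λ k _ →
  cong (λ x → sign^ (i ∸ k) ℤ.* + ((r ∸ k) C (r ∸ i)) ℤ.* + x) (f≡g k)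

hTransform-+ : ∀ f g r i → hTransform (λ k → f k + g k) r i ≡ hTransform f r i ℤ.+ hTransform g r i
hTransform-+ f g r i = trans (sumTo-cong i (λ k _ → distrib k)) (sumTo-+ i (hTerm f r i) (hTerm g r i))
  where
  distrib : ∀ k → hTerm (λ k → f k + g k) r i k ≡ hTerm f r i k ℤ.+ hTerm g r i k
  distrib k = trans (cong (sign^ (i ∸ k) ℤ.* + ((r ∸ k) C (r ∸ i)) ℤ.*_) (ℤP.pos-+ (f k) (g k)))
                    (ℤP.*-distribˡ-+ (sign^ (i ∸ k) ℤ.* + ((r ∸ k) C (r ∸ i))) (+ f k) (+ g k))

hTransform-shift : ∀ g r i → hTransform (shift g) (suc r) (suc i) ≡ hTransform g r i
hTransform-shift g r i = begin
  hTransform (shift g) (suc r) (suc i) ≡⟨ sumTo-suc i (hTerm (shift g) (suc r) (suc i)) ⟩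
  c ℤ.* + 0 ℤ.+ hTransform g r i       ≡⟨ cong (ℤ._+ hTransform g r i) (ℤP.*-zeroʳ c) ⟩
  + 0 ℤ.+ hTransform g r i             ≡⟨ ℤP.+-identityˡ _ ⟩
  hTransform g r i                     ∎
  where
  open ≡-Reasoning
  c : ℤ
  c = sign^ (suc i) ℤ.* + (suc r C (r ∸ i))

hTransform-0 : ∀ f r → hTransform f r 0 ≡ + f 0
hTransform-0 f r = begin
  + 1 ℤ.* + (r C r) ℤ.* + f 0 ≡⟨ cong (ℤ._* + f 0) (ℤP.*-identityˡ (+ (r C r))) ⟩
  + (r C r) ℤ.* + f 0         ≡⟨ cong (λ c → + c ℤ.* + f 0) (nCn≡1 r) ⟩
  + 1 ℤ.* + f 0               ≡⟨ ℤP.*-identityˡ (+ f 0) ⟩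
  + f 0                       ∎
  where open ≡-Reasoning

hTransform-split : ∀ {f g q} → (∀ k → f k ≡ g k + shift q k) →
                   ∀ r i → hTransform f (suc r) (suc i) ≡ hTransform g (suc r) (suc i) ℤ.+ hTransform q r i
hTransform-split {f} {g} {q} f≡ r i = begin
  hTransform f (suc r) (suc i)
    ≡⟨ hTransform-cong f≡ (suc r) (suc i) ⟩
  hTransform (λ k → g k + shift q k) (suc r) (suc i)
    ≡⟨ hTransform-+ g (shift q) (suc r) (suc i) ⟩
  hTransform g (suc r) (suc i) ℤ.+ hTransform (shift q) (suc r) (suc i)
    ≡⟨ cong (λ x → hTransform g (suc r) (suc i) ℤ.+ x) (hTransform-shift q r i) ⟩
  hTransform g (suc r) (suc i) ℤ.+ hTransform q r i ∎
  where open ≡-Reasoning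

private
  suc-∸ : ∀ {m n} → n ≤ m → suc m ∸ n ≡ suc (m ∸ n)
  suc-∸ = ℕP.+-∸-assoc 1

  open +-*-Solver

  pascal-step : ∀ s a b (x : ℤ) →
    ℤ.- s ℤ.* + (suc a C suc b) ℤ.* x ≡ ℤ.- s ℤ.* + (a C b) ℤ.* x ℤ.+ ℤ.- (s ℤ.* + (a C suc b) ℤ.* x)
  pascal-step s a b x rewrite sym (nCk+nC[k+1]≡[n+1]C[k+1] a b) | ℤP.pos-+ (a C b) (a C suc b) =
    solve 4 (λ s c d x → :- s :* (c :+ d) :* x := :- s :* c :* x :+ :- (s :* d :* x))
          refl s (+ (a C b)) (+ (a C suc b)) x

hTransform-pascal : ∀ f {r i} → i ≤ r →
  hTransform f (suc (suc r)) (suc i) ≡ hTransform f (suc r) (suc i) ℤ.- hTransform f (suc r) i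
hTransform-pascal f {r} {i} i≤r = begin
  sumTo i T₁ ℤ.+ T₁ (suc i)
    ≡⟨ cong₂ ℤ._+_ (sumTo-cong i split) diagonal ⟩
  sumTo i (λ k → T₂ k ℤ.+ ℤ.- T₃ k) ℤ.+ T₂ (suc i)
    ≡⟨ cong (ℤ._+ T₂ (suc i)) (trans (sumTo-+ i T₂ (λ k → ℤ.- T₃ k))
                                     (cong (λ x → sumTo i T₂ ℤ.+ x) (sumTo-neg i T₃))) ⟩
  sumTo i T₂ ℤ.+ ℤ.- sumTo i T₃ ℤ.+ T₂ (suc i)
    ≡⟨ solve 3 (λ a b c → a :+ :- b :+ c := a :+ c :+ :- b) refl (sumTo i T₂) (sumTo i T₃) (T₂ (suc i)) ⟩
  hTransform f (suc r) (suc i) ℤ.- hTransform f (suc r) i ∎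
  where
  open ≡-Reasoning
  T₁ T₂ T₃ : ℕ → ℤ
  T₁ = hTerm f (suc (suc r)) (suc i)
  T₂ = hTerm f (suc r) (suc i)
  T₃ = hTerm f (suc r) i
  split : ∀ k → k ≤ i → T₁ k ≡ T₂ k ℤ.+ ℤ.- T₃ k
  split k k≤i rewrite suc-∸ k≤i | suc-∸ (ℕP.m≤n⇒m≤1+n (ℕP.≤-trans k≤i i≤r)) | suc-∸ i≤r =
    pascal-step (sign^ (i ∸ k)) (suc r ∸ k) (r ∸ i) (+ f k)
  diagonal : T₁ (suc i) ≡ T₂ (suc i)
  diagonal = cong (λ c → sign^ (i ∸ i) ℤ.* + c ℤ.* + f (suc i))
                  (trans (nCn≡1 (suc r ∸ i)) (sym (nCn≡1 (r ∸ i))))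

hTransform-top : ∀ f r → hTransform f (suc r) (suc r) ≡ + f (suc r) ℤ.- hTransform f r r
hTransform-top f r = begin
  sumTo r T₁ ℤ.+ T₁ (suc r)
    ≡⟨ cong₂ ℤ._+_ (trans (sumTo-cong r negated) (sumTo-neg r T₃)) diagonal ⟩
  ℤ.- sumTo r T₃ ℤ.+ + f (suc r)
    ≡⟨ ℤP.+-comm (ℤ.- sumTo r T₃) (+ f (suc r)) ⟩
  + f (suc r) ℤ.- hTransform f r r ∎
  where
  open ≡-Reasoning
  T₁ T₃ : ℕ → ℤ
  T₁ = hTerm f (suc r) (suc r)
  T₃ = hTerm f r r
  negated : ∀ k → k ≤ r → T₁ k ≡ ℤ.- T₃ k
  negated k k≤r rewrite suc-∸ k≤r | ℕP.n∸n≡0 r =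
    solve 2 (λ s x → :- s :* con (+ 1) :* x := :- (s :* con (+ 1) :* x)) refl (sign^ (r ∸ k)) (+ f k)
  diagonal : T₁ (suc r) ≡ + f (suc r)
  diagonal rewrite ℕP.n∸n≡0 r = ℤP.*-identityˡ (+ f (suc r))

-- f = g + shift g is the f-vector of a cone over g.
hTransform-cone : ∀ {f g} → (∀ k → f k ≡ g k + shift g k) →
                  ∀ {r i} → i ≤ r → hTransform f (suc (suc r)) (suc i) ≡ hTransform g (suc r) (suc i)
hTransform-cone {f} {g} f≡ {r} {i} i≤r = begin
  hTransform f (suc (suc r)) (suc i)
    ≡⟨ hTransform-split f≡ (suc r) i ⟩
  hTransform g (suc (suc r)) (suc i) ℤ.+ y
    ≡⟨ cong (ℤ._+ y) (hTransform-pascal g i≤r) ⟩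
  x ℤ.- y ℤ.+ y
    ≡⟨ ℤP.+-assoc x (ℤ.- y) y ⟩
  x ℤ.+ (ℤ.- y ℤ.+ y)
    ≡⟨ cong (λ z → x ℤ.+ z) (ℤP.+-inverseˡ y) ⟩
  x ℤ.+ + 0
    ≡⟨ ℤP.+-identityʳ x ⟩
  x ∎
  where
  open ≡-Reasoning
  x y : ℤ
  x = hTransform g (suc r) (suc i)
  y = hTransform g (suc r) i

hTransform-cone-top : ∀ {f g} → (∀ k → f k ≡ g k + shift g k) →
                      ∀ r → g (suc r) ≡ 0 → hTransform f (suc r) (suc r) ≡ + 0
hTransform-cone-top {f} {g} f≡ r g[r+1]≡0 = begin
  hTransform f (suc r) (suc r)      ≡⟨ hTransform-split f≡ r r ⟩
  hTransform g (suc r) (suc r) ℤ.+ y ≡⟨ cong (ℤ._+ y) (hTransform-top g r) ⟩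
  + g (suc r) ℤ.- y ℤ.+ y           ≡⟨ cong (λ c → + c ℤ.- y ℤ.+ y) g[r+1]≡0 ⟩
  + 0 ℤ.- y ℤ.+ y                   ≡⟨ cong (ℤ._+ y) (ℤP.+-identityˡ (ℤ.- y)) ⟩
  ℤ.- y ℤ.+ y                       ≡⟨ ℤP.+-inverseˡ y ⟩
  + 0                               ∎
  where
  open ≡-Reasoning
  y : ℤ
  y = hTransform g r r

module _ (M : Matroid n) where

  extend : ∀ {A B} → Indep M A → Indep M B → ∣ A ∣ ≤ ∣ B ∣ →
           Σ[ A' ∈ Subset n ] A ⊆ A' × A' ⊆ A ∪ B × Indep M A' × ∣ A' ∣ ≡ ∣ B ∣
  extend {A} {B} iA iB ∣A∣≤∣B∣ = go (∣ B ∣ ∸ ∣ A ∣) iA (ℕP.m∸n+n≡m ∣A∣≤∣B∣)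
    where
    go : ∀ d {A} → Indep M A → d + ∣ A ∣ ≡ ∣ B ∣ →
         Σ[ A' ∈ Subset n ] A ⊆ A' × A' ⊆ A ∪ B × Indep M A' × ∣ A' ∣ ≡ ∣ B ∣
    go zero    {A} iA size = A , (λ x∈ → x∈) , SubsetP.p⊆p∪q B , iA , size
    go (suc d) {A} iA size
      with e , e∈B , e∉A , iA+e ← augment M iA iB (subst (∣ A ∣ <_) size (ℕP.m<n+m ∣ A ∣ (s≤s z≤n)))
      with A' , A+e⊆A' , A'⊆ , iA' , size' ←
             go d iA+e (trans (cong (λ x → d + x) (∣∪⁅⁆∣ A e e∉A)) (trans (ℕP.+-suc d ∣ A ∣) size))
      = A' , A+e⊆A' ∘ SubsetP.p⊆p∪q ⁅ e ⁆ , A'⊆A∪B , iA' , size'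
      where
      A'⊆A∪B : A' ⊆ A ∪ B
      A'⊆A∪B x∈ with SubsetP.x∈p∪q⁻ (A ∪ ⁅ e ⁆) B (A'⊆ x∈)
      ... | inj₂ x∈B = SubsetP.q⊆p∪q A B x∈B
      ... | inj₁ x∈A+e with SubsetP.x∈p∪q⁻ A ⁅ e ⁆ x∈A+e
      ...   | inj₁ x∈A = SubsetP.p⊆p∪q B x∈A
      ...   | inj₂ x≡e rewrite SubsetP.x∈⁅y⁆⇒x≡y e x≡e = SubsetP.q⊆p∪q A B e∈B

  -- When r is the rank, the independent r-sets are the bases, so this says that e is not a coloop;
  -- unlike ¬ IsColoop M e it is decidable.
  NonColoop : ℕ → Fin n → Set
  NonColoop r e = Σ[ B ∈ Subset n ] Indep M B × ∣ B ∣ ≡ r × e ∉ B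

  nonColoop? : ∀ r e → Dec (NonColoop r e)
  nonColoop? r e = SubsetP.anySubset? λ B → indep? M B ×-dec (∣ B ∣ ℕ.≟ r) ×-dec ¬? (e SubsetP.∈? B)

  ColoopFree : ℕ → Set
  ColoopFree r = ∀ e → NonColoop r e

  module _ {r : ℕ} (hr : HasRank M r) where
    private
      R : Subset n
      R = proj₁ (proj₁ hr)
      iR : Indep M R
      iR = proj₁ (proj₂ (proj₁ hr))
      ∣R∣ : ∣ R ∣ ≡ r
      ∣R∣ = proj₂ (proj₂ (proj₁ hr))
      ≤r : ∀ A → Indep M A → ∣ A ∣ ≤ r
      ≤r = proj₂ hr

    ∣basis∣≡rank : ∀ {B} → IsBasis M B → ∣ B ∣ ≡ r
    ∣basis∣≡rank {B} (iB , maximal) with ℕP.<-cmp ∣ B ∣ r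
    ... | tri≈ _ eq _ = eq
    ... | tri> _ _ gt = ⊥-elim (ℕP.<⇒≱ gt (≤r B iB))
    ... | tri< lt _ _ with e , _ , e∉B , iB+e ← augment M iB iR (subst (∣ B ∣ <_) (sym ∣R∣) lt)
      = ⊥-elim (maximal (B ∪ ⁅ e ⁆) B⊂B+e iB+e)
      where
      B⊂B+e : B ⊂ B ∪ ⁅ e ⁆
      B⊂B+e = SubsetP.p⊆p∪q ⁅ e ⁆ , e , SubsetP.q⊆p∪q B ⁅ e ⁆ (SubsetP.x∈⁅x⁆ e) , e∉B

    noColoops⇒coloopFree : NoColoops M → ColoopFree r
    noColoops⇒coloopFree noColoops e with nonColoop? r e
    ... | yes avoided = avoided
    ... | no  never   = ⊥-elim (noColoops e λ B isB → e∈B B isB (e SubsetP.∈? B))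
      where
      e∈B : ∀ B → IsBasis M B → Dec (e ∈ B) → e ∈ B
      e∈B B isB (yes e∈B) = e∈B
      e∈B B isB (no e∉B)  = ⊥-elim (never (B , proj₁ isB , ∣basis∣≡rank isB , e∉B))

    loop⇒nonColoop : ∀ e → ¬ Indep M ⁅ e ⁆ → NonColoop r e
    loop⇒nonColoop e loop = R , iR , ∣R∣ , λ e∈R →
      loop (indep-⊆ M (λ x∈ → subst (_∈ R) (sym (SubsetP.x∈⁅y⁆⇒x≡y e x∈)) e∈R) iR)

hasRank-empty : (M : Matroid 0) → ∀ {r} → HasRank M r → r ≡ 0
hasRank-empty M (([] , _ , ∣[]∣≡r) , _) = sym ∣[]∣≡r

-- Deletion and contraction

∣∷∣-mono-< : ∀ (b : Side) {A B : Subset n} → ∣ A ∣ < ∣ B ∣ → ∣ b ∷ A ∣ < ∣ b ∷ B ∣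
∣∷∣-mono-< outside lt = lt
∣∷∣-mono-< inside  lt = s≤s lt

module _ (M : Matroid (suc n)) (p : Fin (suc n)) where

  -- Fixing the side b of p: the deletion for b = outside, the contraction for b = inside.
  fix : (b : Side) → Indep M (insertAt ⊥ p b) → Matroid n
  fix b indep-⊥ = record
    { Indep   = λ S → Indep M (insertAt S p b)
    ; indep?  = λ S → indep? M (insertAt S p b)
    ; indep-∅ = indep-⊥
    ; indep-⊆ = λ A⊆B → indep-⊆ M (insertAt-mono p A⊆B)
    ; augment = augmentFixed
    }
    where
    augmentFixed : ∀ {A B} → Indep M (insertAt A p b) → Indep M (insertAt B p b) → ∣ A ∣ < ∣ B ∣ →
                   Σ[ e ∈ Fin n ] e ∈ B × e ∉ A × Indep M (insertAt (A ∪ ⁅ e ⁆) p b)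
    augmentFixed {A} {B} iA iB lt
      with e , e∈B , e∉A , iA+e ← augment M iA iB
             (subst₂ _<_ (sym (∣insertAt∣ A p b)) (sym (∣insertAt∣ B p b)) (∣∷∣-mono-< b {A} {B} lt))
      with punchInView p e
    ... | at-p      = ⊥-elim (e∉A (p∈insertAt-swap p e∈B))
    ... | punched x = x , punchIn∈insertAt⁻ p e∈B , e∉A ∘ punchIn∈insertAt⁺ p ,
                      indep-⊆ M (insertAt-∪⁅⁆ A p b x) iA+e

  delete : Matroid n
  delete = fix outside (subst (Indep M) (sym (insertAt-⊥-outside p)) (indep-∅ M))

  contract : Indep M ⁅ p ⁆ → Matroid n
  contract nonLoop = fix inside (subst (Indep M) (sym (insertAt-⊥-inside p)) nonLoop)

module _ (M : Matroid (suc n)) (p : Fin (suc n)) where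

  indep-delete : ∀ {B} → p ∉ B → Indep M B → Indep (delete M p) (removeAt B p)
  indep-delete p∉B = subst (Indep M) (sym (removeAt-outside p p∉B))

  indep-contract : ∀ nonLoop {B} → p ∈ B → Indep M B → Indep (contract M p nonLoop) (removeAt B p)
  indep-contract nonLoop p∈B = subst (Indep M) (sym (removeAt-inside p p∈B))

  nonColoop-delete : ∀ {B k f} → Indep M B → ∣ B ∣ ≡ k → p ∉ B → punchIn p f ∉ B →
                     NonColoop (delete M p) k f
  nonColoop-delete {B} iB ∣B∣ p∉B pf∉B =
    removeAt B p , indep-delete p∉B iB , trans (∣removeAt∣-∉ p p∉B) ∣B∣ ,
    punchIn∉removeAt p (removeAt-outside p p∉B) pf∉B

  nonColoop-contract : ∀ nonLoop {B k f} → Indep M B → ∣ B ∣ ≡ suc k → p ∈ B → punchIn p f ∉ B →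
                       NonColoop (contract M p nonLoop) k f
  nonColoop-contract nonLoop {B} iB ∣B∣ p∈B pf∉B =
    removeAt B p , indep-contract nonLoop p∈B iB , ℕP.suc-injective (trans (∣removeAt∣-∈ p p∈B) ∣B∣) ,
    punchIn∉removeAt p (removeAt-inside p p∈B) pf∉B

  hasRank-delete : ∀ {r} → HasRank M r → NonColoop M r p → HasRank (delete M p) r
  hasRank-delete {r} hr (B , iB , ∣B∣ , p∉B) =
    (removeAt B p , indep-delete p∉B iB , trans (∣removeAt∣-∉ p p∉B) ∣B∣) ,
    λ A iA → subst (_≤ r) (∣insertAt∣ A p outside) (proj₂ hr _ iA)

  hasRank-delete-coloop : ∀ {r} → HasRank M (suc r) → ¬ NonColoop M (suc r) p → HasRank (delete M p) r
  hasRank-delete-coloop {r} ((R , iR , ∣R∣) , ≤r) coloop with p SubsetP.∈? R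
  ... | no p∉R  = ⊥-elim (coloop (R , iR , ∣R∣ , p∉R))
  ... | yes p∈R =
    (removeAt R p , indep-⊆ M (insertAt-outside⊆inside p) (subst (Indep M) (sym (removeAt-inside p p∈R)) iR) ,
     ℕP.suc-injective (trans (∣removeAt∣-∈ p p∈R) ∣R∣)) ,
    ≤r-delete
    where
    ≤r-delete : ∀ A → Indep M (insertAt A p outside) → ∣ A ∣ ≤ r
    ≤r-delete A iA with ℕP.m≤n⇒m<n∨m≡n (subst (_≤ suc r) (∣insertAt∣ A p outside) (≤r _ iA))
    ... | inj₁ lt = ℕP.≤-pred lt
    ... | inj₂ eq = ⊥-elim (coloop (insertAt A p outside , iA , trans (∣insertAt∣ A p outside) eq ,
                                    p∉insertAt-outside p))

  module _ {r} (hr : HasRank M (suc r)) (nonLoop : Indep M ⁅ p ⁆) where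

    extendFrom-p : ∀ {B} → Indep M B → ∣ B ∣ ≡ suc r →
                   Σ[ A ∈ Subset (suc n) ] p ∈ A × A ⊆ ⁅ p ⁆ ∪ B × Indep M A × ∣ A ∣ ≡ suc r
    extendFrom-p {B} iB ∣B∣
      with A , p⊆A , A⊆ , iA , ∣A∣ ← extend M nonLoop iB
             (subst₂ _≤_ (sym (SubsetP.∣⁅x⁆∣≡1 p)) (sym ∣B∣) (s≤s z≤n))
      = A , p⊆A (SubsetP.x∈⁅x⁆ p) , A⊆ , iA , trans ∣A∣ ∣B∣

    hasRank-contract : HasRank (contract M p nonLoop) r
    hasRank-contract
      with A , p∈A , _ , iA , ∣A∣ ← extendFrom-p (proj₁ (proj₂ (proj₁ hr))) (proj₂ (proj₂ (proj₁ hr)))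
      = (removeAt A p , indep-contract nonLoop p∈A iA , ℕP.suc-injective (trans (∣removeAt∣-∈ p p∈A) ∣A∣)) ,
        λ A iA → ℕP.≤-pred (subst (_≤ suc r) (∣insertAt∣ A p inside) (proj₂ hr _ iA))

    coloopFree-contract : ColoopFree M (suc r) → ColoopFree (contract M p nonLoop) r
    coloopFree-contract coloopFree f
      with B , iB , ∣B∣ , pf∉B ← coloopFree (punchIn p f)
      with A , p∈A , A⊆ , iA , ∣A∣ ← extendFrom-p iB ∣B∣
      = nonColoop-contract nonLoop iA ∣A∣ p∈A pf∉A
      where
      pf∉A : punchIn p f ∉ A
      pf∉A pf∈A with SubsetP.x∈p∪q⁻ ⁅ p ⁆ B (A⊆ pf∈A)
      ... | inj₁ pf∈p = punchInᵢ≢i p f (SubsetP.x∈⁅y⁆⇒x≡y p pf∈p)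
      ... | inj₂ pf∈B = pf∉B pf∈B

  coloopFree-delete-loop : ∀ {r} → ¬ Indep M ⁅ p ⁆ → ColoopFree M r → ColoopFree (delete M p) r
  coloopFree-delete-loop loop coloopFree f
    with B , iB , ∣B∣ , pf∉B ← coloopFree (punchIn p f)
    = nonColoop-delete iB ∣B∣ p∉B pf∉B
    where
    p∉B : p ∉ B
    p∉B p∈B = loop (indep-⊆ M (λ x∈ → subst (_∈ B) (sym (SubsetP.x∈⁅y⁆⇒x≡y p x∈)) p∈B) iB)

  addable-or-avoided : ∀ {r U B} → HasRank M r → Indep M (insertAt U p outside) → Indep M B → ∣ B ∣ ≡ r →
    Indep M (insertAt U p inside) ⊎
    Σ[ X ∈ Subset (suc n) ] X ⊆ insertAt U p outside ∪ B × Indep M X × ∣ X ∣ ≡ r × p ∉ X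
  addable-or-avoided {r} {U} {B} hr iU iB ∣B∣
    with X , U⊆X , X⊆ , iX , ∣X∣ ← extend M iU iB
           (subst (∣ insertAt U p outside ∣ ≤_) (sym ∣B∣) (proj₂ hr _ iU))
    with p SubsetP.∈? X
  ... | yes p∈X = inj₁ (indep-⊆ M (insertAt-inside-⊆ p p∈X U⊆X) iX)
  ... | no  p∉X = inj₂ (X , X⊆ , iX , trans ∣X∣ ∣B∣ , p∉X)

  coloop-addable : ∀ {r U} → HasRank M r → ¬ NonColoop M r p →
                   Indep M (insertAt U p outside) → Indep M (insertAt U p inside)
  coloop-addable hr@((R , iR , ∣R∣) , _) coloop iU with addable-or-avoided hr iU iR ∣R∣
  ... | inj₁ iU+p                     = iU+p
  ... | inj₂ (X , _ , iX , ∣X∣ , p∉X) = ⊥-elim (coloop (X , iX , ∣X∣ , p∉X))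

-- If f is a coloop of M ∖ p but not of M, then {p, f} is a series pair: (M ∖ p) ∖ f = (M / p) ∖ f.
series-pair : (M : Matroid (suc (suc n))) (p : Fin (suc (suc n))) → ∀ {r} → HasRank M r → ColoopFree M r →
              (nonLoop : Indep M ⁅ p ⁆) → ∀ {f} → ¬ NonColoop (delete M p) r f →
              ∀ {S} → Indep (delete (delete M p) f) S → Indep (delete (contract M p nonLoop) f) S
series-pair M p hr coloopFree nonLoop {f} coloop {S} iS
  with B , iB , ∣B∣ , pf∉B ← coloopFree (punchIn p f)
  with addable-or-avoided M p hr iS iB ∣B∣
... | inj₁ iS+p = iS+p
... | inj₂ (X , X⊆ , iX , ∣X∣ , p∉X) = ⊥-elim (coloop (nonColoop-delete M p iX ∣X∣ p∉X pf∉X))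
  where
  pf∉X : punchIn p f ∉ X
  pf∉X pf∈X with SubsetP.x∈p∪q⁻ _ B (X⊆ pf∈X)
  ... | inj₁ pf∈S = p∉insertAt-outside f (punchIn∈insertAt⁻ p pf∈S)
  ... | inj₂ pf∈B = pf∉B pf∈B

-- f- and h-vectors of minors

h : Matroid n → ℕ → ℕ → ℤ
h M = hTransform (fvec M)

module _ (M : Matroid n) where

  fvec-above-rank : ∀ {r} → HasRank M r → ∀ {k} → r < k → fvec M k ≡ 0
  fvec-above-rank hr {k} r<k = countSubsets-none (sized (indep? M) k)
    (λ S (iS , ∣S∣) → ℕP.<⇒≱ r<k (subst (_≤ _) ∣S∣ (proj₂ hr S iS)))

  h-0 : ∀ r → h M r 0 ≡ + 1
  h-0 r = trans (hTransform-0 (fvec M) r) (cong +_ (countOfSize-0 (indep? M) (indep-∅ M)))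

module _ (M : Matroid (suc n)) (p : Fin (suc n)) where

  fvecThrough : ℕ → ℕ
  fvecThrough = countOfSize (λ S → indep? M (insertAt S p inside))

  fvec-delete-contract : ∀ nonLoop k → fvec M k ≡ fvec (delete M p) k + shift (fvec (contract M p nonLoop)) k
  fvec-delete-contract nonLoop = countOfSize-insertAt (indep? M) p

  fvec-delete-loop : ¬ Indep M ⁅ p ⁆ → ∀ k → fvec M k ≡ fvec (delete M p) k
  fvec-delete-loop loop k = begin
    fvec M k                                         ≡⟨ countOfSize-insertAt (indep? M) p k ⟩
    fvec (delete M p) k + shift fvecThrough k        ≡⟨ cong (λ x → fvec (delete M p) k + x) (noneThrough k) ⟩
    fvec (delete M p) k + 0                          ≡⟨ ℕP.+-identityʳ _ ⟩
    fvec (delete M p) k                              ∎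
    where
    open ≡-Reasoning
    noneThrough : ∀ k → shift fvecThrough k ≡ 0
    noneThrough zero    = refl
    noneThrough (suc k) = countSubsets-none (sized (λ S → indep? M (insertAt S p inside)) k)
      (λ S (iS , _) → loop (indep-⊆ M (⁅p⁆⊆insertAt-inside p) iS))

  fvec-delete-coloop : ∀ {r} → HasRank M r → ¬ NonColoop M r p →
                       ∀ k → fvec M k ≡ fvec (delete M p) k + shift (fvec (delete M p)) k
  fvec-delete-coloop hr coloop k =
    trans (countOfSize-insertAt (indep? M) p k) (cong (λ x → fvec (delete M p) k + x) (throughIsDelete k))
    where
    throughIsDelete : ∀ k → shift fvecThrough k ≡ shift (fvec (delete M p)) k
    throughIsDelete zero    = refl
    throughIsDelete (suc k) = countOfSize-cong (λ S → indep? M (insertAt S p inside)) (indep? (delete M p))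
      (indep-⊆ M (insertAt-outside⊆inside p)) (coloop-addable M p hr coloop) k

  h-delete-contract : ∀ nonLoop r i →
    h M (suc r) (suc i) ≡ h (delete M p) (suc r) (suc i) ℤ.+ h (contract M p nonLoop) r i
  h-delete-contract nonLoop = hTransform-split (fvec-delete-contract nonLoop)

  h-delete-loop : ¬ Indep M ⁅ p ⁆ → ∀ r i → h M r i ≡ h (delete M p) r i
  h-delete-loop loop = hTransform-cong (fvec-delete-loop loop)

  h-delete-coloop : ∀ {r} → HasRank M (suc (suc r)) → ¬ NonColoop M (suc (suc r)) p →
                    ∀ {i} → i ≤ r → h M (suc (suc r)) (suc i) ≡ h (delete M p) (suc r) (suc i)
  h-delete-coloop hr coloop = hTransform-cone (fvec-delete-coloop hr coloop)

  h-top-coloop : ∀ {r} → HasRank M (suc r) → ¬ NonColoop M (suc r) p → h M (suc r) (suc r) ≡ + 0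
  h-top-coloop {r} hr coloop = hTransform-cone-top (fvec-delete-coloop hr coloop) r
    (fvec-above-rank (delete M p) (hasRank-delete-coloop M p hr coloop) ℕP.≤-refl)

x≤x+y : ∀ {x y : ℤ} → + 0 ℤ.≤ y → x ℤ.≤ x ℤ.+ y
x≤x+y {x} 0≤y = subst (ℤ._≤ x ℤ.+ _) (ℤP.+-identityʳ x) (ℤP.+-monoʳ-≤ x 0≤y)

h-nonneg : (M : Matroid n) → ∀ {r} → HasRank M r → ∀ {i} → i ≤ r → + 0 ℤ.≤ h M r i
h-nonneg M {r} hr {zero} _ = subst (+ 0 ℤ.≤_) (sym (h-0 M r)) (ℤ.+≤+ z≤n)
h-nonneg {zero} M hr {suc i} i≤r with () ← subst (suc i ≤_) (hasRank-empty M hr) i≤r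
h-nonneg {suc n} M {suc r} hr {suc i} (s≤s i≤r) with indep? M ⁅ zero ⁆
... | no loop = subst (+ 0 ℤ.≤_) (sym (h-delete-loop M zero loop (suc r) (suc i)))
  (h-nonneg (delete M zero) (hasRank-delete M zero hr (loop⇒nonColoop M hr zero loop)) (s≤s i≤r))
... | yes nonLoop with nonColoop? M (suc r) zero
...   | yes nonColoop = subst (+ 0 ℤ.≤_) (sym (h-delete-contract M zero nonLoop r i))
  (ℤP.+-mono-≤ (h-nonneg (delete M zero) (hasRank-delete M zero hr nonColoop) (s≤s i≤r))
               (h-nonneg (contract M zero nonLoop) (hasRank-contract M zero hr nonLoop) i≤r))
...   | no coloop with ℕP.m≤n⇒m<n∨m≡n i≤r
...     | inj₁ (s≤s i≤r') = subst (+ 0 ℤ.≤_) (sym (h-delete-coloop M zero hr coloop i≤r'))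
  (h-nonneg (delete M zero) (hasRank-delete-coloop M zero hr coloop) (s≤s i≤r'))
...     | inj₂ refl = ℤP.≤-reflexive (sym (h-top-coloop M zero hr coloop))

h-top-pos : (M : Matroid n) → ∀ {r} → HasRank M r → ColoopFree M r → + 1 ℤ.≤ h M r r
h-top-pos M {zero} hr coloopFree = ℤP.≤-reflexive (sym (h-0 M 0))
h-top-pos {zero} M {suc r} hr coloopFree with () ← hasRank-empty M hr
h-top-pos {suc n} M {suc r} hr coloopFree with indep? M ⁅ zero ⁆
... | no loop = subst (+ 1 ℤ.≤_) (sym (h-delete-loop M zero loop (suc r) (suc r)))
  (h-top-pos (delete M zero) (hasRank-delete M zero hr (loop⇒nonColoop M hr zero loop))
             (coloopFree-delete-loop M zero loop coloopFree))
... | yes nonLoop = subst (+ 1 ℤ.≤_) (sym (h-delete-contract M zero nonLoop r r))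
  (ℤP.+-mono-≤ (h-nonneg (delete M zero) (hasRank-delete M zero hr (coloopFree zero)) ℕP.≤-refl)
               (h-top-pos (contract M zero nonLoop) (hasRank-contract M zero hr nonLoop)
                          (coloopFree-contract M zero hr nonLoop coloopFree)))

h-delete-≤ : (M : Matroid (suc n)) (p : Fin (suc n)) → ∀ {r} → HasRank M (suc r) →
             ∀ {i} → i ≤ r → h (delete M p) (suc r) (suc i) ℤ.≤ h M (suc r) (suc i)
h-delete-≤ M p {r} hr {i} i≤r with indep? M ⁅ p ⁆
... | no loop     = ℤP.≤-reflexive (sym (h-delete-loop M p loop (suc r) (suc i)))
... | yes nonLoop = subst (h (delete M p) (suc r) (suc i) ℤ.≤_) (sym (h-delete-contract M p nonLoop r i))
  (x≤x+y (h-nonneg (contract M p nonLoop) (hasRank-contract M p hr nonLoop) i≤r))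

h-delete-≤-contract : (M : Matroid (suc (suc n))) (p : Fin (suc (suc n))) →
  ∀ {r} → HasRank M (suc r) → ColoopFree M (suc r) → (nonLoop : Indep M ⁅ p ⁆) →
  ∀ {f} → ¬ NonColoop (delete M p) (suc r) f →
  ∀ {i} → i ≤ r → h (delete M p) (suc r) i ℤ.≤ h (contract M p nonLoop) r i
h-delete-≤-contract M p {r} hr coloopFree nonLoop coloop {zero} _ =
  ℤP.≤-reflexive (trans (h-0 (delete M p) (suc r)) (sym (h-0 (contract M p nonLoop) r)))
h-delete-≤-contract {n} M p {suc r} hr coloopFree nonLoop {f} coloop {suc i} (s≤s i≤r) = begin
  h D (suc (suc r)) (suc i)      ≡⟨ h-delete-coloop D f (hasRank-delete M p hr (coloopFree p)) coloop i≤r ⟩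
  h (delete D f) (suc r) (suc i) ≡⟨ hTransform-cong seriesPair (suc r) (suc i) ⟩
  h (delete Q f) (suc r) (suc i) ≤⟨ h-delete-≤ Q f (hasRank-contract M p hr nonLoop) i≤r ⟩
  h Q (suc r) (suc i)            ∎
  where
  open ℤP.≤-Reasoning
  D Q : Matroid (suc n)
  D = delete M p
  Q = contract M p nonLoop
  seriesPair : ∀ k → fvec (delete D f) k ≡ fvec (delete Q f) k
  seriesPair = countOfSize-cong (indep? (delete D f)) (indep? (delete Q f))
    (series-pair M p hr coloopFree nonLoop coloop) (indep-⊆ M (insertAt-outside⊆inside p))

-- The bound

binomPrev : ℕ → ℕ → ℕ
binomPrev r zero    = 0
binomPrev r (suc j) = r C j

binomPrev-pascal : ∀ r j → binomPrev r j + r C j ≡ suc r C j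
binomPrev-pascal r zero    = refl
binomPrev-pascal r (suc j) = nCk+nC[k+1]≡[n+1]C[k+1] r j

-- The inequality of the theorem for rank r + 1 and i = j.
HBound : Matroid n → ℕ → ℕ → Set
HBound M r j = h M (suc r) (suc r ∸ j) ℤ.≤ + (r C j) ℤ.* h M (suc r) (suc r) ℤ.+ + binomPrev r j

HBounds : ℕ → Set₁
HBounds n = (M : Matroid n) → ∀ {r} → HasRank M (suc r) → ColoopFree M (suc r) →
            ∀ {j} → j ≤ suc r → HBound M r j

private
  b≤b*q : ∀ b {q} → + 1 ℤ.≤ q → + b ℤ.≤ + b ℤ.* q
  b≤b*q b 1≤q = subst (ℤ._≤ + b ℤ.* _) (ℤP.*-identityʳ (+ b)) (ℤP.*-monoˡ-≤-nonNeg (+ b) 1≤q)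

  bound-sum-coloopFree : ∀ {x y d q : ℤ} {B} b c (e : ℤ) → B ≡ b + c →
    x ℤ.≤ + B ℤ.* d ℤ.+ e → y ℤ.≤ + c ℤ.* q ℤ.+ + b → + 1 ℤ.≤ q →
    x ℤ.+ y ℤ.≤ + B ℤ.* (d ℤ.+ q) ℤ.+ e
  bound-sum-coloopFree {x} {y} {d} {q} b c e refl x≤ y≤ 1≤q = begin
    x ℤ.+ y
      ≤⟨ ℤP.+-mono-≤ x≤ (ℤP.≤-trans y≤ (ℤP.+-monoʳ-≤ (+ c ℤ.* q) (b≤b*q b 1≤q))) ⟩
    + (b + c) ℤ.* d ℤ.+ e ℤ.+ (+ c ℤ.* q ℤ.+ + b ℤ.* q)
      ≡⟨ cong (λ B → B ℤ.* d ℤ.+ e ℤ.+ (+ c ℤ.* q ℤ.+ + b ℤ.* q)) (ℤP.pos-+ b c) ⟩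
    (+ b ℤ.+ + c) ℤ.* d ℤ.+ e ℤ.+ (+ c ℤ.* q ℤ.+ + b ℤ.* q)
      ≡⟨ solve 5 (λ b c d q e → (b :+ c) :* d :+ e :+ (c :* q :+ b :* q) := (b :+ c) :* (d :+ q) :+ e)
               refl (+ b) (+ c) d q e ⟩
    (+ b ℤ.+ + c) ℤ.* (d ℤ.+ q) ℤ.+ e
      ≡⟨ cong (λ B → B ℤ.* (d ℤ.+ q) ℤ.+ e) (ℤP.pos-+ b c) ⟨
    + (b + c) ℤ.* (d ℤ.+ q) ℤ.+ e ∎
    where open ℤP.≤-Reasoning

  bound-sum-coloop : ∀ {x y z d q : ℤ} {B E} b c e → B ≡ b + c → E ≡ e + b → d ≡ + 0 →
    x ℤ.≤ z → z ℤ.≤ + b ℤ.* q ℤ.+ + e → y ℤ.≤ + c ℤ.* q ℤ.+ + b →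
    x ℤ.+ y ℤ.≤ + B ℤ.* (d ℤ.+ q) ℤ.+ + E
  bound-sum-coloop {x} {y} {q = q} b c e refl refl refl x≤z z≤ y≤ = begin
    x ℤ.+ y
      ≤⟨ ℤP.+-mono-≤ (ℤP.≤-trans x≤z z≤) y≤ ⟩
    + b ℤ.* q ℤ.+ + e ℤ.+ (+ c ℤ.* q ℤ.+ + b)
      ≡⟨ solve 4 (λ b c e q → b :* q :+ e :+ (c :* q :+ b) := (b :+ c) :* (con (+ 0) :+ q) :+ (e :+ b))
               refl (+ b) (+ c) (+ e) q ⟩
    (+ b ℤ.+ + c) ℤ.* (+ 0 ℤ.+ q) ℤ.+ (+ e ℤ.+ + b)
      ≡⟨ cong₂ (λ B E → B ℤ.* (+ 0 ℤ.+ q) ℤ.+ E) (ℤP.pos-+ b c) (ℤP.pos-+ e b) ⟨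
    + (b + c) ℤ.* (+ 0 ℤ.+ q) ℤ.+ + (e + b) ∎
    where open ℤP.≤-Reasoning

hBound-from-minors : (M : Matroid (suc n)) (p : Fin (suc n)) (nonLoop : Indep M ⁅ p ⁆) → ∀ {r j} → j ≤ r →
  let D = delete M p; Q = contract M p nonLoop in
  h D (suc (suc r)) (suc r ∸ j) ℤ.+ h Q (suc r) (r ∸ j) ℤ.≤
    + (suc r C suc j) ℤ.* (h D (suc (suc r)) (suc (suc r)) ℤ.+ h Q (suc r) (suc r)) ℤ.+ + (suc r C j) →
  HBound M (suc r) (suc j)
hBound-from-minors M p nonLoop {r} {j} j≤r =
  subst₂ (λ x y → x ℤ.≤ + (suc r C suc j) ℤ.* y ℤ.+ + (suc r C j))
         (sym lower) (sym (h-delete-contract M p nonLoop (suc r) (suc r)))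
  where
  lower : h M (suc (suc r)) (suc r ∸ j) ≡
          h (delete M p) (suc (suc r)) (suc r ∸ j) ℤ.+ h (contract M p nonLoop) (suc r) (r ∸ j)
  lower rewrite suc-∸ j≤r = h-delete-contract M p nonLoop (suc r) (r ∸ j)

hBound-deletion-coloopFree : HBounds n → (M : Matroid (suc n)) → ∀ {r} → HasRank M (suc (suc r)) →
  ColoopFree M (suc (suc r)) → (nonLoop : Indep M ⁅ zero ⁆) →
  ColoopFree (delete M zero) (suc (suc r)) → ∀ {j} → j ≤ r → HBound M (suc r) (suc j)
hBound-deletion-coloopFree {n} IH M {r} hr coloopFree nonLoop coloopFreeD {j} j≤r =
  hBound-from-minors M zero nonLoop j≤r
    (bound-sum-coloopFree (r C j) (r C suc j) (+ (suc r C j)) (sym (nCk+nC[k+1]≡[n+1]C[k+1] r j))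
      (IH (delete M zero) (hasRank-delete M zero hr (coloopFree zero)) coloopFreeD (s≤s (ℕP.m≤n⇒m≤1+n j≤r)))
      (IH Q hrQ cfQ (s≤s j≤r))
      (h-top-pos Q hrQ cfQ))
  where
  Q : Matroid n
  Q = contract M zero nonLoop
  hrQ : HasRank Q (suc r)
  hrQ = hasRank-contract M zero hr nonLoop
  cfQ : ColoopFree Q (suc r)
  cfQ = coloopFree-contract M zero hr nonLoop coloopFree

hBound-deletion-coloop : HBounds n → (M : Matroid (suc n)) → ∀ {r} → HasRank M (suc (suc r)) →
  ColoopFree M (suc (suc r)) → (nonLoop : Indep M ⁅ zero ⁆) →
  Σ[ f ∈ Fin n ] ¬ NonColoop (delete M zero) (suc (suc r)) f → ∀ {j} → j ≤ r → HBound M (suc r) (suc j)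
hBound-deletion-coloop {suc n} IH M {r} hr coloopFree nonLoop (f , coloop) {j} j≤r =
  hBound-from-minors M zero nonLoop j≤r
    (bound-sum-coloop (r C j) (r C suc j) (binomPrev r j)
      (sym (nCk+nC[k+1]≡[n+1]C[k+1] r j)) (sym (binomPrev-pascal r j))
      (h-top-coloop (delete M zero) f (hasRank-delete M zero hr (coloopFree zero)) coloop)
      (h-delete-≤-contract M zero hr coloopFree nonLoop coloop (ℕP.m∸n≤m (suc r) j))
      (IH Q hrQ cfQ (ℕP.m≤n⇒m≤1+n j≤r))
      (IH Q hrQ cfQ (s≤s j≤r)))
  where
  Q : Matroid (suc n)
  Q = contract M zero nonLoop
  hrQ : HasRank Q (suc r)
  hrQ = hasRank-contract M zero hr nonLoop
  cfQ : ColoopFree Q (suc r)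
  cfQ = coloopFree-contract M zero hr nonLoop coloopFree

hBound : HBounds n
hBound M {r} hr coloopFree {zero} _ =
  ℤP.≤-reflexive (sym (trans (ℤP.+-identityʳ _) (ℤP.*-identityˡ (h M (suc r) (suc r)))))
hBound {zero} M hr coloopFree {suc j} _ with () ← hasRank-empty M hr
hBound {suc n} M {r} hr coloopFree {suc j} j<r with indep? M ⁅ zero ⁆
... | no loop = subst₂ (λ x y → x ℤ.≤ + (r C suc j) ℤ.* y ℤ.+ + (r C j))
  (sym (h-delete-loop M zero loop (suc r) (r ∸ j))) (sym (h-delete-loop M zero loop (suc r) (suc r)))
  (hBound (delete M zero) (hasRank-delete M zero hr (loop⇒nonColoop M hr zero loop))
          (coloopFree-delete-loop M zero loop coloopFree) j<r)
... | yes nonLoop with ℕP.m≤n⇒m<n∨m≡n (ℕP.≤-pred j<r)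
...   | inj₂ refl = ℤP.≤-reflexive (begin
  h M (suc j) (j ∸ j)                                 ≡⟨ cong (h M (suc j)) (ℕP.n∸n≡0 j) ⟩
  h M (suc j) 0                                       ≡⟨ h-0 M (suc j) ⟩
  + 0 ℤ.* h M (suc j) (suc j) ℤ.+ + 1
    ≡⟨ cong₂ (λ a b → + a ℤ.* h M (suc j) (suc j) ℤ.+ + b) (k>n⇒nCk≡0 (ℕP.n<1+n j)) (nCn≡1 j) ⟨
  + (j C suc j) ℤ.* h M (suc j) (suc j) ℤ.+ + (j C j) ∎)
  where open ≡-Reasoning
...   | inj₁ (s≤s j≤r) with all? (nonColoop? (delete M zero) (suc r))
...     | yes coloopFreeD = hBound-deletion-coloopFree hBound M hr coloopFree nonLoop coloopFreeD j≤r
...     | no ¬coloopFreeD = hBound-deletion-coloop hBound M hr coloopFree nonLoop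
                              (¬∀⟶∃¬ n _ (nonColoop? (delete M zero) (suc r)) ¬coloopFreeD) j≤r

+m-+n≡+[m∸n] : ∀ {m n} → n ≤ m → + m ℤ.- + n ≡ + (m ∸ n)
+m-+n≡+[m∸n] {m} {n} n≤m = trans (ℤP.m-n≡m⊖n m n) (ℤP.⊖-≥ n≤m)

falling-≤ : ∀ {a b} → b ≤ a → falling (+ a) b ≡ + (a P′ b)
falling-≤ {a} {zero}  _   = refl
falling-≤ {a} {suc b} b<a = begin
  falling (+ a) b ℤ.* (+ a ℤ.- + b) ≡⟨ cong₂ ℤ._*_ (falling-≤ b≤a) (+m-+n≡+[m∸n] b≤a) ⟩
  + (a P′ b) ℤ.* + (a ∸ b)          ≡⟨ ℤP.pos-* (a P′ b) (a ∸ b) ⟨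
  + ((a P′ b) ℕ.* (a ∸ b))          ≡⟨ cong +_ (ℕP.*-comm (a P′ b) (a ∸ b)) ⟩
  + (a P′ suc b)                    ∎
  where
  open ≡-Reasoning
  b≤a : b ≤ a
  b≤a = ℕP.<⇒≤ b<a

falling-> : ∀ {a b} → a < b → falling (+ a) b ≡ + 0
falling-> {a} {suc b} (s≤s a≤b) with ℕP.m≤n⇒m<n∨m≡n a≤b
... | inj₁ a<b  = trans (cong (ℤ._* (+ a ℤ.- + b)) (falling-> a<b)) (ℤP.*-zeroˡ (+ a ℤ.- + b))
... | inj₂ refl = trans (cong (falling (+ a) a ℤ.*_) (ℤP.+-inverseʳ (+ a))) (ℤP.*-zeroʳ (falling (+ a) a))

binomℤ-pos : ∀ a b → binomℤ (+ a) (+ b) ≡ + (a C b)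
binomℤ-pos a b with ℕP.≤-<-connex b a
... | inj₁ b≤a = begin
  (falling (+ a) b /ℕ b !) {{b !≢0}} ≡⟨ cong (λ x → (x /ℕ b !) {{b !≢0}}) (falling-≤ b≤a) ⟩
  + ((a P′ b) ℕ./ b !) {{b !≢0}}     ≡⟨ cong (λ x → + (x ℕ./ b !) {{b !≢0}}) P′≡P ⟩
  + ((a P b) ℕ./ b !) {{b !≢0}}      ≡⟨ cong +_ (nCk≡nPk/k! b≤a) ⟨
  + (a C b)                          ∎
  where
  open ≡-Reasoning
  P′≡P : a P′ b ≡ a P b
  P′≡P = trans (nP′k≡n!/[n∸k]! b≤a) (sym (nPk≡n!/[n∸k]! b≤a))
... | inj₂ a<b = trans (cong (λ x → (x /ℕ b !) {{b !≢0}}) (falling-> a<b))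
                       (cong +_ (trans (0/n≡0 (b !) {{b !≢0}}) (sym (k>n⇒nCk≡0 a<b))))

binomℤ-pred : ∀ r i → binomℤ (+ r) (+ i ℤ.- + 1) ≡ + binomPrev r i
binomℤ-pred r zero    = refl
binomℤ-pred r (suc i) = binomℤ-pos r i

hvec≡h : (M : Matroid n) → ∀ {r i} → i ≤ r → hvec M r i ≡ h M r i
hvec≡h M {r} {i} i≤r = sumTo-cong i λ k k≤i →
  cong (λ c → sign^ (i ∸ k) ℤ.* c ℤ.* + fvec M k) (begin
    binomℤ (+ r ℤ.- + k) (+ r ℤ.- + i)
      ≡⟨ cong₂ binomℤ (+m-+n≡+[m∸n] (ℕP.≤-trans k≤i i≤r)) (+m-+n≡+[m∸n] i≤r) ⟩
    binomℤ (+ (r ∸ k)) (+ (r ∸ i))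
      ≡⟨ binomℤ-pos (r ∸ k) (r ∸ i) ⟩
    + ((r ∸ k) C (r ∸ i)) ∎)
  where open ≡-Reasoning

mainTheorem9 : ∀ {n} (M : Matroid n) (r : ℕ) → HasRank M r → NoColoops M →
    ∀ (i : ℕ) → i ≤ r →
    hvec M r (r ∸ i) ℤ.≤ binomℤ (+ r ℤ.- + 1) (+ i) ℤ.* hvec M r r ℤ.+ binomℤ (+ r ℤ.- + 1) (+ i ℤ.- + 1)
mainTheorem9 M zero hr noColoops zero z≤n = ℤP.≤-reflexive (sym (trans (ℤP.+-identityʳ _) (ℤP.*-identityˡ _)))
mainTheorem9 M (suc r) hr noColoops i i≤r = begin
  hvec M (suc r) (suc r ∸ i)
    ≡⟨ hvec≡h M (ℕP.m∸n≤m (suc r) i) ⟩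
  h M (suc r) (suc r ∸ i)
    ≤⟨ hBound M hr (noColoops⇒coloopFree M hr noColoops) i≤r ⟩
  + (r C i) ℤ.* h M (suc r) (suc r) ℤ.+ + binomPrev r i
    ≡⟨ cong₂ (λ c d → c ℤ.* h M (suc r) (suc r) ℤ.+ d) (binomℤ-pos r i) (binomℤ-pred r i) ⟨
  binomℤ (+ r) (+ i) ℤ.* h M (suc r) (suc r) ℤ.+ binomℤ (+ r) (+ i ℤ.- + 1)
    ≡⟨ cong (λ top → binomℤ (+ r) (+ i) ℤ.* top ℤ.+ binomℤ (+ r) (+ i ℤ.- + 1))
            (hvec≡h M (ℕP.≤-refl {suc r})) ⟨
  binomℤ (+ r) (+ i) ℤ.* hvec M (suc r) (suc r) ℤ.+ binomℤ (+ r) (+ i ℤ.- + 1) ∎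
  where open ℤP.≤-Reasoning
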